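{- Let $T$ be a tree that contains a path $v_1v_2\cdots v_k$ (its spine) such that $T$ is the union of this path together with, for each $i\in[k]$, at most two paths starting at $v_i$, where all these attached paths are pairwise disjoint except at their starting vertices and meet the spine only in their starting vertex. Then $\chi_\rho(T)\le 7$.
   Context: For a graph $X$, a packing $k$-coloring is a map $c\colon V(X)\to\{1,\dots,k\}$ such that whenever $u\neq v$ and $c(u)=c(v)=\ell$, the shortest-path distance satisfies $d_X(u,v)>\ell$; the packing chromatic number $\chi_\rho(X)$ is the least $k$ for which a packing $k$-coloring exists. -}

module Defs where

open import Data.Nat using (ℕ; zero; suc; _≤_; _<_)
open import Data.Fin using (Fin; toℕ)
open import Data.Product using (Σ; _×_; _,_)
open import Data.Sum using (_⊎_)
open import Relation.Nullary using (¬_)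
open import Relation.Binary.PropositionalEquality using (_≡_; _≢_)

record Graph : Set₁ where
  field
    V   : Set
    Adj : V → V → Set

open Graph public

data Walk (G : Graph) : V G → V G → ℕ → Set where
  here : ∀ {u} → Walk G u u zero
  step : ∀ {u w v m} → Adj G u w → Walk G w v m → Walk G u v (suc m)

DistLe : (G : Graph) → V G → V G → ℕ → Set
DistLe G u v ℓ = Σ ℕ λ m → m ≤ ℓ × Walk G u v m

DistGt : (G : Graph) → V G → V G → ℕ → Set
DistGt G u v ℓ = ¬ DistLe G u v ℓ

-- colour of c(u) as a number in {1,…,k}: colours Fin k, colour i means i+1
colour : ∀ {k} → Fin k → ℕ
colour i = suc (toℕ i)

IsPackingColouring : (G : Graph) (k : ℕ) → (V G → Fin k) → Set
IsPackingColouring G k c =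
  ∀ u v → u ≢ v → c u ≡ c v → DistGt G u v (colour (c u))

PackingChromaticLe : Graph → ℕ → Set
PackingChromaticLe G b =
  Σ ℕ λ k → k ≤ b × Σ (V G → Fin k) λ c → IsPackingColouring G k c

-- Spine v_1 … v_k  (spine i, i : Fin k); at each spine vertex v_i two
-- (possibly empty) attached paths, side s : Fin 2, of length len i s;
-- leg i s j is the (j+1)-th vertex of that path after v_i.
-- Length 0 means the path is absent, so this covers "at most two".

data SpiderV (k : ℕ) (len : Fin k → Fin 2 → ℕ) : Set where
  spine : Fin k → SpiderV k len
  leg   : (i : Fin k) (s : Fin 2) → Fin (len i s) → SpiderV k len

data SpiderE (k : ℕ) (len : Fin k → Fin 2 → ℕ) :
             SpiderV k len → SpiderV k len → Set where
  spineE : (i j : Fin k) → toℕ j ≡ suc (toℕ i) →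
           SpiderE k len (spine i) (spine j)
  baseE  : (i : Fin k) (s : Fin 2) (j : Fin (len i s)) → toℕ j ≡ 0 →
           SpiderE k len (spine i) (leg i s j)
  legE   : (i : Fin k) (s : Fin 2) (j j' : Fin (len i s)) →
           toℕ j' ≡ suc (toℕ j) →
           SpiderE k len (leg i s j) (leg i s j')

SpineTree : (k : ℕ) → (Fin k → Fin 2 → ℕ) → Graph
SpineTree k len = record
  { V   = SpiderV k len
  ; Adj = λ u v → SpiderE k len u v ⊎ SpiderE k len v u
  }

{-# OPTIONS --safe #-}
-- Colour the spine v₀ v₁ … periodically with 2 4 3 5 2 6 3 4 2 5 3 7 and every attached path,
-- from its first vertex on, periodically with 1 x 1 y where {x , y} = {2 , 3} and x = 3 exactly
-- when the foot has colour 2. Each colour sequence is periodic, so being a packing colouring of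
-- a path is a finite check. Across different paths the large colours 4–7 only occur on the
-- spine, and 2 and 3 only occur at height at least 2 on attached paths; the one delicate pair is
-- a colour-3 spine vertex against the second vertex of a path whose foot has colour 2, and they
-- are far enough apart because colour-2 and colour-3 spine vertices are never adjacent.
module Submission where

open import Defs
open import Data.Nat using (ℕ; _≤_)
open import Data.Fin using (Fin)
open import Data.Nat using (zero; suc; _+_; _*_; _<_; z≤n; s≤s; ∣_-_∣; NonZero; _≤?_)
open import Data.Nat.DivMod using (_%_; _/_; _mod_; m≡m%n+[m/n]*n; m%n<n)
open import Data.Nat.Properties
  using (≤-refl; ≤-trans; ≤-total; ≰⇒>; <⇒≱; n≤1+n; m≤n⇒m≤1+n; m≤m+n; +-mono-≤; +-monoʳ-≤;
         +-assoc; +-comm; +-identityʳ; n≢0⇒n>0; m≤n⇒∃[o]m+o≡n;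
         ∣n-n∣≡0; ∣-∣-comm; ∣m-m+n∣≡n; ∣m-n∣≡0⇒m≡n)
open import Data.Fin using (toℕ; fromℕ<; _≟_) renaming (zero to fzero; suc to fsuc)
open import Data.Fin.Properties using (toℕ<n; toℕ-fromℕ<; toℕ-injective; all?)
open import Data.Bool using (Bool; true; false)
open import Data.Product using (_×_; _,_; proj₁; proj₂)
open import Data.Sum using (_⊎_; inj₁; inj₂)
import Data.Sum as Sum
open import Function using (_∘_; id)
open import Relation.Nullary using (¬_; yes; no; does; contradiction)
open import Relation.Nullary.Decidable using (True; toWitness; ¬?; _×-dec_; _→-dec_)
open import Relation.Unary using (Decidable)
open import Relation.Binary.PropositionalEquality
  using (_≡_; _≢_; refl; sym; trans; cong; subst; subst₂)

∀-by-period : ∀ {P : ℕ → Set} p .{{_ : NonZero p}} → (∀ a → P a → P (p + a)) →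
              (∀ (r : Fin p) → P (toℕ r)) → ∀ a → P a
∀-by-period {P} p shift window a =
  subst P (trans (+-comm _ (a % p)) (sym (m≡m%n+[m/n]*n a p))) (lift (a / p) residue)
  where
  residue : P (a % p)
  residue = subst P (toℕ-fromℕ< (m%n<n a p)) (window (a mod p))
  lift : ∀ q {r} → P r → P (q * p + r)
  lift zero    Pr = Pr
  lift (suc q) {r} Pr = subst P (sym (+-assoc p (q * p) r)) (shift _ (lift q Pr))

decide-by-period : ∀ {P : ℕ → Set} p .{{_ : NonZero p}} → (∀ a → P a → P (p + a)) →
                   (P? : Decidable P) → {True (all? (P? ∘ toℕ))} → ∀ a → P a
decide-by-period p shift P? {window} = ∀-by-period p shift (toWitness {a? = all? (P? ∘ toℕ)} window)

IsPathPacking : ∀ {n} → (ℕ → Fin n) → Set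
IsPathPacking f = ∀ a t → f a ≡ f (a + suc t) → colour (f a) ≤ t

PackingAt : ∀ {n} → (ℕ → Fin n) → ℕ → Set
PackingAt {n} f a = ∀ (t : Fin n) → f a ≡ f (a + suc (toℕ t)) → colour (f a) ≤ toℕ t

packingAt? : ∀ {n} (f : ℕ → Fin n) → Decidable (PackingAt f)
packingAt? f a = all? λ t → f a ≟ f (a + suc (toℕ t)) →-dec colour (f a) ≤? toℕ t

bounded-packing : ∀ {n} {f : ℕ → Fin n} → (∀ a → PackingAt f a) → IsPathPacking f
bounded-packing {n} {f} bounded a t with n ≤? t
... | yes n≤t = λ _ → ≤-trans (toℕ<n (f a)) n≤t
... | no  n≰t = subst (λ t → f a ≡ f (a + suc t) → colour (f a) ≤ t) (toℕ-fromℕ< t<n)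
                      (bounded a (fromℕ< t<n))
  where t<n = ≰⇒> n≰t

path-packing-apart-≤ : ∀ {n} {f : ℕ → Fin n} → IsPathPacking f →
                       ∀ {a b} → a ≤ b → a ≢ b → f a ≡ f b → colour (f a) < ∣ a - b ∣
path-packing-apart-≤ {f = f} packing {a} a≤b a≢b fa≡fb with m≤n⇒∃[o]m+o≡n a≤b
... | zero  , refl = contradiction (+-identityʳ a) (a≢b ∘ sym)
... | suc t , refl = subst (colour (f a) <_) (sym (∣m-m+n∣≡n a (suc t))) (s≤s (packing a t fa≡fb))

path-packing-apart : ∀ {n} {f : ℕ → Fin n} → IsPathPacking f →
                     ∀ {a b} → a ≢ b → f a ≡ f b → colour (f a) < ∣ a - b ∣
path-packing-apart packing {a} {b} a≢b fa≡fb with ≤-total a b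
... | inj₁ a≤b = path-packing-apart-≤ packing a≤b a≢b fa≡fb
... | inj₂ b≤a = subst₂ _<_ (cong colour (sym fa≡fb)) (∣-∣-comm b a)
                        (path-packing-apart-≤ packing b≤a (a≢b ∘ sym) (sym fa≡fb))

-- cℓ is the colour ℓ: colour i = toℕ i + 1.
pattern c1 = fzero
pattern c2 = fsuc c1
pattern c3 = fsuc c2
pattern c4 = fsuc c3
pattern c5 = fsuc c4
pattern c6 = fsuc c5
pattern c7 = fsuc c6

spineColour : ℕ → Fin 7
spineColour (suc (suc (suc (suc (suc (suc (suc (suc (suc (suc (suc (suc a)))))))))))) = spineColour a
spineColour 0  = c2
spineColour 1  = c4
spineColour 2  = c3
spineColour 3  = c5
spineColour 4  = c2
spineColour 5  = c6
spineColour 6  = c3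
spineColour 7  = c4
spineColour 8  = c2
spineColour 9  = c5
spineColour 10 = c3
spineColour 11 = c7

-- The flag says whether the foot has colour 2; the vertex at height 2 must then avoid colour 2.
legColour : Bool → ℕ → Fin 7
legColour b     (suc (suc (suc (suc j)))) = legColour b j
legColour b     0 = c1
legColour true  1 = c3
legColour false 1 = c2
legColour b     2 = c1
legColour true  3 = c2
legColour false 3 = c3

spineColour-packing : IsPathPacking spineColour
spineColour-packing =
  bounded-packing (decide-by-period 12 (λ _ → id) (packingAt? spineColour))

legColour-packing : ∀ b → IsPathPacking (legColour b)
legColour-packing true  =
  bounded-packing (decide-by-period 4 (λ _ → id) (packingAt? (legColour true)))
legColour-packing false =
  bounded-packing (decide-by-period 4 (λ _ → id) (packingAt? (legColour false)))

spineColour-≢c1 : ∀ a → spineColour a ≢ c1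
spineColour-≢c1 = decide-by-period 12 (λ _ → id) (λ a → ¬? (spineColour a ≟ c1))

spineColour-2-3-nonadjacent : ∀ a → ¬ (spineColour a ≡ c2 × spineColour (suc a) ≡ c3) ×
                                    ¬ (spineColour a ≡ c3 × spineColour (suc a) ≡ c2)
spineColour-2-3-nonadjacent = decide-by-period 12 (λ _ → id) λ a →
  ¬? (spineColour a ≟ c2 ×-dec spineColour (suc a) ≟ c3) ×-dec
  ¬? (spineColour a ≟ c3 ×-dec spineColour (suc a) ≟ c2)

∣m-n∣<2⇒adjacent : ∀ m n → ∣ m - n ∣ < 2 → m ≡ n ⊎ n ≡ suc m ⊎ m ≡ suc n
∣m-n∣<2⇒adjacent zero          zero          _ = inj₁ refl
∣m-n∣<2⇒adjacent zero          (suc zero)    _ = inj₂ (inj₁ refl)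
∣m-n∣<2⇒adjacent (suc zero)    zero          _ = inj₂ (inj₂ refl)
∣m-n∣<2⇒adjacent (suc m)       (suc n)       p =
  Sum.map (cong suc) (Sum.map (cong suc) (cong suc)) (∣m-n∣<2⇒adjacent m n p)
∣m-n∣<2⇒adjacent zero          (suc (suc n)) (s≤s (s≤s ()))
∣m-n∣<2⇒adjacent (suc (suc m)) zero          (s≤s (s≤s ()))

spineColour-3-2-apart : ∀ {a b} → spineColour a ≡ c3 → spineColour b ≡ c2 → 2 ≤ ∣ a - b ∣
spineColour-3-2-apart {a} {b} a↦3 b↦2 with 2 ≤? ∣ a - b ∣
... | yes apart = apart
... | no  close with ∣m-n∣<2⇒adjacent a b (≰⇒> close)
...   | inj₁ refl = contradiction (trans (sym a↦3) b↦2) λ ()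
...   | inj₂ (inj₁ refl) = contradiction (a↦3 , b↦2) (proj₂ (spineColour-2-3-nonadjacent a))
...   | inj₂ (inj₂ refl) = contradiction (b↦2 , a↦3) (proj₁ (spineColour-2-3-nonadjacent b))

legColour-≤3 : ∀ b j → colour (legColour b j) ≤ 3
legColour-≤3 b     (suc (suc (suc (suc j)))) = legColour-≤3 b j
legColour-≤3 b     0 = s≤s z≤n
legColour-≤3 true  1 = s≤s (s≤s (s≤s z≤n))
legColour-≤3 false 1 = s≤s (s≤s z≤n)
legColour-≤3 b     2 = s≤s z≤n
legColour-≤3 true  3 = s≤s (s≤s z≤n)
legColour-≤3 false 3 = s≤s (s≤s (s≤s z≤n))

hasColour2 : ℕ → Bool
hasColour2 a = does (spineColour a ≟ c2)

spine-leg-apart : ∀ a a' j → spineColour a ≡ legColour (hasColour2 a') j →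
                  colour (spineColour a) < suc j + ∣ a - a' ∣
spine-leg-apart a a' 0 a↦1 = contradiction a↦1 (spineColour-≢c1 a)
spine-leg-apart a a' 2 a↦1 = contradiction a↦1 (spineColour-≢c1 a)
spine-leg-apart a a' (suc (suc (suc j))) same =
  s≤s (≤-trans (subst (λ c → colour c ≤ 3) (sym same) (legColour-≤3 (hasColour2 a') (3 + j)))
               (s≤s (s≤s (s≤s z≤n))))
spine-leg-apart a a' 1 same with spineColour a' ≟ c2
... | yes a'↦2 rewrite same = s≤s (s≤s (spineColour-3-2-apart {a} {a'} same a'↦2))
... | no  a'↦̸2 rewrite same = s≤s (s≤s (n≢0⇒n>0 (λ d≡0 →
        a'↦̸2 (subst (λ x → spineColour x ≡ c2) (∣m-n∣≡0⇒m≡n {a} {a'} d≡0) same))))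

leg-leg-apart : ∀ b b' j j' → legColour b j ≡ legColour b' j' → colour (legColour b j) < suc j + suc j'
leg-leg-apart b b' 0       j'      _    = s≤s (s≤s z≤n)
leg-leg-apart b b' (suc j) 0       same rewrite same = s≤s (s≤s z≤n)
leg-leg-apart b b' (suc j) (suc j') _   =
  ≤-trans (s≤s (legColour-≤3 b (suc j))) (+-mono-≤ (s≤s (s≤s z≤n)) (s≤s (s≤s z≤n)))

WithinOne : ℕ → ℕ → Set
WithinOne m n = m ≤ suc n × n ≤ suc m

withinOne-sym : ∀ {m n} → WithinOne m n → WithinOne n m
withinOne-sym (m≤1+n , n≤1+m) = n≤1+m , m≤1+n

withinOne-suc : ∀ n → WithinOne n (suc n)
withinOne-suc n = m≤n⇒m≤1+n (n≤1+n n) , ≤-refl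

withinOne-+ˡ : ∀ c {m n} → WithinOne m n → WithinOne (c + m) (c + n)
withinOne-+ˡ zero    close = close
withinOne-+ˡ (suc c) close with withinOne-+ˡ c close
... | m≤1+n , n≤1+m = s≤s m≤1+n , s≤s n≤1+m

withinOne-∣-∣ : ∀ a x → WithinOne ∣ a - x ∣ ∣ suc a - x ∣
withinOne-∣-∣ zero    zero    = withinOne-suc 0
withinOne-∣-∣ zero    (suc x) = withinOne-sym (withinOne-suc x)
withinOne-∣-∣ (suc a) zero    = withinOne-suc (suc a)
withinOne-∣-∣ (suc a) (suc x) = withinOne-∣-∣ a x

lipschitz⇒≤walk : ∀ {G : Graph} (h : V G → ℕ) → (∀ {u w} → Adj G u w → h u ≤ suc (h w)) →
                  ∀ {u v m} → Walk G u v m → h u ≤ m + h v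
lipschitz⇒≤walk h lipschitz here         = ≤-refl
lipschitz⇒≤walk h lipschitz (step uw wv) = ≤-trans (lipschitz uw) (s≤s (lipschitz⇒≤walk h lipschitz wv))

module _ {k : ℕ} {len : Fin k → Fin 2 → ℕ} where

  data BranchView (i : Fin k) (s : Fin 2) : SpiderV k len → Set where
    on-branch  : (y : Fin (len i s)) → BranchView i s (leg i s y)
    off-branch : ∀ {v} → (∀ y → v ≢ leg i s y) → BranchView i s v

  branchView : ∀ i s v → BranchView i s v
  branchView i s (spine x)    = off-branch λ _ ()
  branchView i s (leg x s' y) with i ≟ x | s ≟ s'
  ... | yes refl | yes refl = on-branch y
  ... | yes refl | no  s≢s' = off-branch λ { _ refl → s≢s' refl }
  ... | no  i≢x  | _        = off-branch λ { _ refl → i≢x refl }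

  spineDist : Fin k → SpiderV k len → ℕ
  spineDist i (spine x)   = ∣ toℕ i - toℕ x ∣
  spineDist i (leg x _ y) = suc (toℕ y) + ∣ toℕ i - toℕ x ∣

  legDist : ∀ {i s v} → Fin (len i s) → BranchView i s v → ℕ
  legDist {i} {v = v} j (off-branch _) = suc (toℕ j) + spineDist i v
  legDist             j (on-branch y)  = ∣ toℕ j - toℕ y ∣

  dist : SpiderV k len → SpiderV k len → ℕ
  dist (spine i)   v = spineDist i v
  dist (leg i s j) v = legDist j (branchView i s v)

  dist-self : ∀ v → dist v v ≡ 0
  dist-self (spine i) = ∣n-n∣≡0 (toℕ i)
  dist-self (leg i s j) with branchView i s (leg i s j)
  ... | on-branch .j       = ∣n-n∣≡0 (toℕ j)
  ... | off-branch not-on = contradiction refl (not-on j)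

  spineDist-step : ∀ {i j} → toℕ j ≡ suc (toℕ i) → ∀ v → WithinOne (spineDist i v) (spineDist j v)
  spineDist-step {i} j≡1+i (spine x)   rewrite j≡1+i = withinOne-∣-∣ (toℕ i) (toℕ x)
  spineDist-step {i} j≡1+i (leg x _ y) rewrite j≡1+i =
    withinOne-+ˡ (suc (toℕ y)) (withinOne-∣-∣ (toℕ i) (toℕ x))

  dist-edge : ∀ {u w} → SpiderE k len u w → ∀ v → WithinOne (dist u v) (dist w v)
  dist-edge (spineE i j j≡1+i) v = spineDist-step j≡1+i v
  dist-edge (baseE i s j j≡0) v with branchView i s v
  ... | on-branch y rewrite j≡0 | ∣n-n∣≡0 (toℕ i) | +-identityʳ (toℕ y) =
    withinOne-sym (withinOne-suc (toℕ y))
  ... | off-branch _ rewrite j≡0 = withinOne-suc (spineDist i v)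
  dist-edge (legE i s j j' j'≡1+j) v with branchView i s v
  ... | on-branch y  rewrite j'≡1+j = withinOne-∣-∣ (toℕ j) (toℕ y)
  ... | off-branch _ rewrite j'≡1+j = withinOne-suc (suc (toℕ j) + spineDist i v)

  dist≤length : ∀ {u v m} → Walk (SpineTree k len) u v m → dist u v ≤ m
  dist≤length {v = v} {m} walk =
    subst (_ ≤_) (trans (cong (m +_) (dist-self v)) (+-identityʳ m))
          (lipschitz⇒≤walk (λ x → dist x v) adjacent walk)
    where
    adjacent : ∀ {u w} → Adj (SpineTree k len) u w → dist u v ≤ suc (dist w v)
    adjacent (inj₁ uw) = proj₁ (dist-edge uw v)
    adjacent (inj₂ wu) = proj₂ (dist-edge wu v)

  treeColour : SpiderV k len → Fin 7
  treeColour (spine i)   = spineColour (toℕ i)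
  treeColour (leg i _ j) = legColour (hasColour2 (toℕ i)) (toℕ j)

  treeColour-apart : ∀ u v → u ≢ v → treeColour u ≡ treeColour v → colour (treeColour u) < dist u v
  treeColour-apart (spine a) (spine b) u≢v same =
    path-packing-apart spineColour-packing (u≢v ∘ cong spine ∘ toℕ-injective) same
  treeColour-apart (spine a) (leg i _ j) _ same = spine-leg-apart (toℕ a) (toℕ i) (toℕ j) same
  treeColour-apart (leg i _ j) (spine a) _ same =
    subst₂ (λ c d → colour c < suc (toℕ j) + d) (sym same) (∣-∣-comm (toℕ a) (toℕ i))
           (spine-leg-apart (toℕ a) (toℕ i) (toℕ j) (sym same))
  treeColour-apart (leg i s j) (leg x s' y) u≢v same with branchView i s (leg x s' y)
  ... | on-branch .y =
    path-packing-apart (legColour-packing _) (u≢v ∘ cong (leg i s) ∘ toℕ-injective) same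
  ... | off-branch _ =
    ≤-trans (leg-leg-apart _ _ (toℕ j) (toℕ y) same)
            (+-monoʳ-≤ (suc (toℕ j)) (m≤m+n (suc (toℕ y)) ∣ toℕ i - toℕ x ∣))

lemma4p2 : (k : ℕ) → 1 ≤ k → (len : Fin k → Fin 2 → ℕ) →
           PackingChromaticLe (SpineTree k len) 7
-- The colouring works for the empty spine too.
lemma4p2 k _ len = 7 , ≤-refl , treeColour , λ u v u≢v same (m , m≤c , walk) →
  <⇒≱ (treeColour-apart u v u≢v same) (≤-trans (dist≤length walk) m≤c)
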